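{- Let $R$ be a commutative ring of characteristic $p$, $\Gamma=SL_2(\mathbb{Z})$, $r\ge0$ an even integer, and let $\varphi\in\mathrm{Bound}_\Gamma(V_r(R))$ be a boundary symbol. Then: (a) if $r<2p$, then $L(\varphi,i+1)=0$ for all $0\le i\le r$ with $i\not\equiv0,r\pmod{p-1}$; (b) for arbitrary even $r$, if $\varphi|T_p=\varphi$, then $L(\varphi,i+1)=0$ for all $0\le i\le r$ with $i\neq0,r$.
   Context: $W_r(R)$ is the $R$-module of homogeneous polynomials of degree $r$ in $R[X,Y]$, with right action of $M_2^+(\mathbb{Z})$ (integer matrices of positive determinant) $(F|\sigma)(X,Y)=F((X,Y)\sigma')$, where $\left(\begin{smallmatrix}a&b\\c&d\end{smallmatrix}\right)'=\left(\begin{smallmatrix}d&-b\\-c&a\end{smallmatrix}\right)$; $V_r(R)=\mathrm{Hom}_R(W_r(R),R)$ with $(\lambda|\sigma)(F)=\lambda(F|\sigma')$, and $\langle\,,\rangle:V_r(R)\times W_r(R)\to R$ is evaluation. $\Delta_0\subset\Delta=\mathrm{Div}(\mathbb{P}^1(\mathbb{Q}))$ is the subgroup of degree-zero divisors, with $GL_2(\mathbb{Q})$ acting by fractional linear transformations. Modular symbols: $\mathrm{Symb}_\Gamma(V)=\mathrm{Hom}(\Delta_0,V)^\Gamma$ with $(\phi|\sigma)(D)=\phi(\sigma D)|\sigma$. For $\lambda\in V_r(R)^{\Gamma_\infty}$ ($\Gamma_\infty$ the stabilizer of $\infty$ in $\Gamma$), define $\tilde\phi_{\infty,\lambda}:\mathbb{P}^1(\mathbb{Q})\to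 V_r(R)$ by $\tilde\phi_{\infty,\lambda}(\gamma\infty)=\lambda|\gamma^{ -1}$ for $\gamma\in\Gamma$ (every cusp is of this form), extend additively to $\Delta$, and let $\phi_{\infty,\lambda}$ be its restriction to $\Delta_0$. $\mathrm{Bound}_\Gamma(V_r(R))$ is the subgroup of $\mathrm{Symb}_\Gamma(V_r(R))$ generated by these $\phi_{\infty,\lambda}$. For $\phi\in\mathrm{Symb}_\Gamma(V_r(R))$ and $0\le i\le r$, $L(\phi,i+1)=\langle\phi((\infty)-(0)),(-1)^iX^{r-i}Y^i\rangle$. The Hecke operator is $\phi|T_p=\phi|\left(\begin{smallmatrix}p&0\\0&1\end{smallmatrix}\right)+\sum_{k=0}^{p-1}\phi|\left(\begin{smallmatrix}1&k\\0&p\end{smallmatrix}\right)$. -}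

module Defs where

open import Level using (Level; _⊔_)
open import Data.Nat as ℕ using (ℕ; zero; suc; _∸_)
open import Data.Integer as ℤ using (ℤ; +_; -[1+_]; 0ℤ)
open import Data.Rational as ℚ using (ℚ; 0ℚ)
import Data.Rational.Properties as ℚP
open import Data.Fin using (Fin; toℕ)
open import Data.List using (List; []; _∷_; _++_; map)
open import Data.Product using (Σ; _×_; _,_; proj₁; proj₂; ∃)
open import Data.List.Relation.Unary.All using (All)
open import Relation.Nullary using (yes; no; ¬_)
open import Relation.Binary.PropositionalEquality using (_≡_; refl; cong)
open import Algebra.Bundles using (CommutativeRing)
open import Data.Nat.Divisibility using (_∣_)

record M2 : Set where
  constructor mat
  field a b c d : ℤ

det : M2 → ℤ
det (mat a b c d) = a ℤ.* d ℤ.- b ℤ.* c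

IsSL2 : M2 → Set
IsSL2 σ = det σ ≡ + 1

-- adjugate  σ' = (d -b ; -c a)   (equals σ⁻¹ when det σ = 1)
adj : M2 → M2
adj (mat a b c d) = mat d (ℤ.- b) (ℤ.- c) a

data P1 : Set where
  ∞   : P1
  fin : ℚ → P1

P1-≟ : (x y : P1) → Relation.Nullary.Dec (x ≡ y)
P1-≟ ∞ ∞ = yes refl
P1-≟ ∞ (fin _) = no (λ ())
P1-≟ (fin _) ∞ = no (λ ())
P1-≟ (fin x) (fin y) with x ℚP.≟ y
... | yes refl = yes refl
... | no ne = no (λ { refl → ne refl })

ℤtoℚ : ℤ → ℚ
ℤtoℚ n = n ℚ./ 1

frac : ℚ → ℚ → P1
frac p q with q ℚP.≟ 0ℚ
... | yes _ = ∞
... | no q≢0 = fin (ℚ._÷_ p q {{ℚ.≢-nonZero q≢0}})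

act : M2 → P1 → P1
act (mat a b c d) ∞ = frac (ℤtoℚ a) (ℤtoℚ c)
act (mat a b c d) (fin x) =
  frac (ℤtoℚ a ℚ.* x ℚ.+ ℤtoℚ b) (ℤtoℚ c ℚ.* x ℚ.+ ℤtoℚ d)

-- Divisors  Δ = Div(P¹(ℚ)) as formal sums  Σ nᵢ (xᵢ)

Div : Set
Div = List (ℤ × P1)

coeff : Div → P1 → ℤ
coeff [] x = 0ℤ
coeff ((n , y) ∷ D) x with P1-≟ y x
... | yes _ = n ℤ.+ coeff D x
... | no _  = coeff D x

deg : Div → ℤ
deg [] = 0ℤ
deg ((n , _) ∷ D) = n ℤ.+ deg D

_≈D_ : Div → Div → Set
D ≈D D' = ∀ x → coeff D x ≡ coeff D' x

actDiv : M2 → Div → Div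
actDiv σ [] = []
actDiv σ ((n , x) ∷ D) = (n , act σ x) ∷ actDiv σ D

deg-actDiv : ∀ σ D → deg (actDiv σ D) ≡ deg D
deg-actDiv σ [] = refl
deg-actDiv σ ((n , x) ∷ D) = cong (λ z → n ℤ.+ z) (deg-actDiv σ D)

deg-++ : ∀ D D' → deg (D ++ D') ≡ deg D ℤ.+ deg D'
deg-++ [] D' = Relation.Binary.PropositionalEquality.sym (Data.Integer.Properties.+-identityˡ (deg D'))
  where import Data.Integer.Properties
deg-++ ((n , _) ∷ D) D' =
  Relation.Binary.PropositionalEquality.trans
    (cong (λ z → n ℤ.+ z) (deg-++ D D'))
    (Relation.Binary.PropositionalEquality.sym (Data.Integer.Properties.+-assoc n (deg D) (deg D')))
  where import Data.Integer.Properties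

Div0 : Set
Div0 = Σ Div (λ D → deg D ≡ 0ℤ)

_+D0_ : Div0 → Div0 → Div0
(D , p) +D0 (D' , p') = D ++ D' , Relation.Binary.PropositionalEquality.trans (deg-++ D D')
  (Relation.Binary.PropositionalEquality.cong₂ ℤ._+_ p p')

actDiv0 : M2 → Div0 → Div0
actDiv0 σ (D , p) = actDiv σ D , Relation.Binary.PropositionalEquality.trans (deg-actDiv σ D) p

D∞0 : Div0
D∞0 = ((+ 1 , ∞) ∷ (ℤ.- (+ 1) , fin 0ℚ) ∷ []) , refl

module _ {c ℓ : Level} (R : CommutativeRing c ℓ) where
  open CommutativeRing R renaming (Carrier to C)

  natR : ℕ → C
  natR zero = 0#
  natR (suc n) = 1# + natR n

  intR : ℤ → C
  intR (+ n) = natR n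
  intR -[1+ n ] = - natR (suc n)

  HasChar : ℕ → Set ℓ
  HasChar p = ∀ n → (natR n ≈ 0# → p ∣ n) × (p ∣ n → natR n ≈ 0#)

  sumFin : (n : ℕ) → (Fin n → C) → C
  sumFin zero f = 0#
  sumFin (suc n) f = f Fin.zero + sumFin n (λ k → f (Fin.suc k))
    where import Data.Fin as Fin

  -- homogeneous polynomials in X,Y as coefficient lists:
  -- the k-th entry is the coefficient of X^(deg-k) Y^k
  padd : List C → List C → List C
  padd [] q = q
  padd (x ∷ p) [] = x ∷ p
  padd (x ∷ p) (y ∷ q) = (x + y) ∷ padd p q

  pscale : C → List C → List C
  pscale s = map (s *_)

  pmul : List C → List C → List C
  pmul [] q = []
  pmul (x ∷ p) q = padd (pscale x q) (0# ∷ pmul p q)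

  ppow : List C → ℕ → List C
  ppow q zero = 1# ∷ []
  ppow q (suc n) = pmul q (ppow q n)

  coeffAt : List C → ℕ → C
  coeffAt [] _ = 0#
  coeffAt (x ∷ _) zero = x
  coeffAt (_ ∷ p) (suc k) = coeffAt p k

  -- W_r(R) : F k = coefficient of X^(r-k) Y^k
  W : ℕ → Set c
  W r = Fin (suc r) → C

  -- (F|σ)(X,Y) = F((X,Y)σ') = F(dX − cY, −bX + aY)
  _∣W_ : {r : ℕ} → W r → M2 → W r
  _∣W_ {r} F (mat a b c' d) j =
    sumFin (suc r) (λ k →
      F k * coeffAt (pmul (ppow (intR d ∷ intR (ℤ.- c') ∷ []) (r ∸ toℕ k))
                          (ppow (intR (ℤ.- b) ∷ intR a ∷ []) (toℕ k)))
                    (toℕ j))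

  -- V_r(R) = Hom_R(W_r(R), R) : functions W_r → R, required to be R-linear
  V : ℕ → Set c
  V r = W r → C

  IsLinear : {r : ℕ} → V r → Set (c ⊔ ℓ)
  IsLinear {r} λ' =
    (∀ F G → (∀ k → F k ≈ G k) → λ' F ≈ λ' G) ×
    (∀ F G → λ' (λ k → F k + G k) ≈ λ' F + λ' G) ×
    (∀ s F → λ' (λ k → s * F k) ≈ s * λ' F)

  _∣V_ : {r : ℕ} → V r → M2 → V r
  (λ' ∣V σ) F = λ' (F ∣W adj σ)

  _≈V_ : {r : ℕ} → V r → V r → Set (c ⊔ ℓ)
  λ' ≈V μ = ∀ F → λ' F ≈ μ F

  _+V_ : {r : ℕ} → V r → V r → V r
  (λ' +V μ) F = λ' F + μ F

  0V : {r : ℕ} → V r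
  0V F = 0#

  _·V_ : {r : ℕ} → ℤ → V r → V r
  (n ·V λ') F = intR n * λ' F

  ⟨_,_⟩ : {r : ℕ} → V r → W r → C
  ⟨ λ' , F ⟩ = λ' F

  _∣S_ : {r : ℕ} → (Div0 → V r) → M2 → (Div0 → V r)
  (φ ∣S σ) D = φ (actDiv0 σ D) ∣V σ

  IsHom : {r : ℕ} → (Div0 → V r) → Set (c ⊔ ℓ)
  IsHom φ =
    (∀ D → IsLinear (φ D)) ×
    (∀ D D' → proj₁ D ≈D proj₁ D' → φ D ≈V φ D') ×
    (∀ D D' → φ (D +D0 D') ≈V (φ D +V φ D'))

  IsSymbol : {r : ℕ} → (Div0 → V r) → Set (c ⊔ ℓ)
  IsSymbol φ = IsHom φ × (∀ γ → IsSL2 γ → ∀ D → (φ ∣S γ) D ≈V φ D)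

  IsΓ∞Inv : {r : ℕ} → V r → Set (c ⊔ ℓ)
  IsΓ∞Inv λ' = IsLinear λ' × (∀ γ → IsSL2 γ → act γ ∞ ≡ ∞ → (λ' ∣V γ) ≈V λ')

  IsTildePhi : {r : ℕ} → V r → (P1 → V r) → Set (c ⊔ ℓ)
  IsTildePhi λ' φ̃ = ∀ γ → IsSL2 γ → φ̃ (act γ ∞) ≈V (λ' ∣V adj γ)

  extendDiv : {r : ℕ} → (P1 → V r) → Div → V r
  extendDiv φ̃ [] = 0V
  extendDiv φ̃ ((n , x) ∷ D) = (n ·V φ̃ x) +V extendDiv φ̃ D

  record BoundGen (r : ℕ) : Set (c ⊔ ℓ) where
    field
      mult  : ℤ
      lam   : V r
      tilde : P1 → V r
      lamInv : IsΓ∞Inv lam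
      tildeSpec : IsTildePhi lam tilde

  sumGens : {r : ℕ} → List (BoundGen r) → Div → V r
  sumGens [] D = 0V
  sumGens (g ∷ gs) D = (BoundGen.mult g ·V extendDiv (BoundGen.tilde g) D) +V sumGens gs D

  IsBoundary : {r : ℕ} → (Div0 → V r) → Set (c ⊔ ℓ)
  IsBoundary {r} φ = ∃ λ (gs : List (BoundGen r)) → ∀ D → φ D ≈V sumGens gs (proj₁ D)

  sumSymb : {r : ℕ} → (n : ℕ) → (ℕ → Div0 → V r) → Div0 → V r
  sumSymb zero f D = 0V
  sumSymb (suc n) f D = f n D +V sumSymb n f D

  Tp : {r : ℕ} → ℕ → (Div0 → V r) → (Div0 → V r)
  Tp p φ D =
    (φ ∣S mat (+ p) 0ℤ 0ℤ (+ 1)) D +V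
    sumSymb p (λ k → φ ∣S mat (+ 1) (+ k) 0ℤ (+ p)) D

  -- L(φ, i+1) = ⟨ φ((∞) − (0)), (−1)^i X^(r−i) Y^i ⟩

  signR : ℕ → C
  signR zero = 1#
  signR (suc n) = - signR n

  monoW : {r : ℕ} → Fin (suc r) → W r
  monoW {r} i k with toℕ k ℕ.≟ toℕ i
  ... | yes _ = signR (toℕ i)
  ... | no _  = 0#

  Lval : {r : ℕ} → (Div0 → V r) → Fin (suc r) → C
  Lval φ i = ⟨ φ D∞0 , monoW i ⟩

{-# OPTIONS --safe #-}
module Submission where

-- A boundary symbol is a ℤ-combination of symbols φ_{∞,λ} with λ ∈ V_r(R)^{Γ∞}, and at a cusp γ∞
-- (γ ∈ SL₂(ℤ)) the function φ̃_{∞,λ} pairs F with λ(F|γ).  Both parts therefore come down to showing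
-- that such a λ vanishes on the monomials X^{r-l} Y^l reached this way.
--
-- Invariance under T = (1 1; 0 1) gives λ(F(X, X + Y) − F(X, Y)) = 0.  For F = X^{r-n-1} Y^{n+1} the
-- difference is Σ_{l ≤ n} C(n+1, l) X^{r-l} Y^l, whose top coefficient is n + 1; when n + 1 is a unit
-- this kills X^{r-n} Y^n by induction on n.  So λ(X^r) = 0 as soon as r ≥ 1, and when r is even and
-- r < 2p, λ kills X^{r-l} Y^l for every l < r with l ≠ p − 1: the only multiple of p among the n + 1 ≤ r
-- is p itself, and for p ≤ n the coefficient C(n+1, p−1) at the skipped index is divisible by p.
--
-- (a) The cusps ∞ = I∞ and 0 = S∞ pair λ with X^{r-i} Y^i and with X^i Y^{r-i}.
-- (b) Expand L(φ, i+1) = L(φ|T_p, i+1).  The terms of (p 0; 0 1) and (1 0; 0 p) contain a factor p^{r-i}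
-- or p^i.  For 0 < k < p the term of (1 k; 0 p) evaluates φ̃_{∞,λ} at the cusps ∞ and k/p = γ∞ on
-- F(X, kX) ∈ R·X^r; as γ has lower-left entry p, R·X^r is stable under |γ, and λ(X^r) = 0 kills it.

open import Defs
open import Level using (Level)
open import Data.Nat using (ℕ; _∸_; _*_; _<_)
open import Data.Nat.Divisibility using (_∣_)
open import Data.Nat.Primality using (Prime)
open import Data.Fin using (Fin; toℕ)
open import Data.Nat using (suc)
open import Data.Product using (_×_)
open import Relation.Nullary using (¬_)
open import Relation.Binary.PropositionalEquality using (_≢_)
open import Algebra.Bundles using (CommutativeRing)

open import Level using (_⊔_)
open import Data.Nat as ℕ using (zero; _≤_; z≤n; s≤s; nonTrivial⇒n>1)
import Data.Nat.Properties as ℕP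
open import Data.Nat.Combinatorics
  using (_C_; nCk+nC[k+1]≡[n+1]C[k+1]; nC1≡n; nCn≡1; nCk≡nC[n∸k]; k>n⇒nCk≡0)
open import Data.Nat.Divisibility using (divides; ∣⇒≤; ∣m∣n⇒∣m+n; _∣0; ∣-refl)
open import Data.Nat.Primality using (euclidsLemma; prime⇒irreducible; prime⇒nonTrivial)
open import Data.Nat.Coprimality as Coprimality using (Coprime; coprime-Bézout)
open import Data.Nat.GCD using (module Bézout)
open import Data.Integer as ℤ using (+_; 0ℤ)
import Data.Integer.Properties as ℤP
open import Data.Integer.Tactic.RingSolver using (solve-∀)
open import Data.Rational using (0ℚ)
import Data.Rational.Properties as ℚP
import Data.Fin as Fin
import Data.Fin.Properties as FinP
open import Data.List using (List; []; _∷_)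
open import Data.List.Relation.Unary.All using (All; []; _∷_)
open import Data.Product using (∃; ∃₂; _,_; proj₁; proj₂)
open import Data.Sum using (_⊎_; inj₁; inj₂)
open import Data.Empty using (⊥)
open import Function using (_∘_)
open import Relation.Nullary using (yes; no; contradiction)
open import Relation.Binary.Definitions using (tri<; tri≈; tri>)
open import Relation.Binary.PropositionalEquality as ≡ using (_≡_; refl; cong; cong₂; subst)

[1+k]*[1+n]C[1+k]≡[1+n]*nCk : ∀ n k → suc k * (suc n C suc k) ≡ suc n * (n C k)
[1+k]*[1+n]C[1+k]≡[1+n]*nCk zero    zero    = refl
[1+k]*[1+n]C[1+k]≡[1+n]*nCk zero    (suc k) = ℕP.*-zeroʳ (suc (suc k))
[1+k]*[1+n]C[1+k]≡[1+n]*nCk (suc n) zero    =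
  ≡.trans (ℕP.+-identityʳ _) (≡.trans (nC1≡n (suc (suc n))) (≡.sym (ℕP.*-identityʳ _)))
[1+k]*[1+n]C[1+k]≡[1+n]*nCk (suc n) (suc k) = begin
  suc (suc k) * (suc (suc n) C suc (suc k))
    ≡⟨ cong (suc (suc k) *_) (nCk+nC[k+1]≡[n+1]C[k+1] (suc n) (suc k)) ⟨
  suc (suc k) * (A ℕ.+ B)
    ≡⟨ ℕP.*-distribˡ-+ (suc (suc k)) A B ⟩
  (A ℕ.+ suc k * A) ℕ.+ suc (suc k) * B
    ≡⟨ cong₂ (λ x y → (A ℕ.+ x) ℕ.+ y) ([1+k]*[1+n]C[1+k]≡[1+n]*nCk n k)
                                      ([1+k]*[1+n]C[1+k]≡[1+n]*nCk n (suc k)) ⟩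
  (A ℕ.+ suc n * (n C k)) ℕ.+ suc n * (n C suc k)
    ≡⟨ ℕP.+-assoc A _ _ ⟩
  A ℕ.+ (suc n * (n C k) ℕ.+ suc n * (n C suc k))
    ≡⟨ cong (A ℕ.+_) (ℕP.*-distribˡ-+ (suc n) (n C k) (n C suc k)) ⟨
  A ℕ.+ suc n * (n C k ℕ.+ n C suc k)
    ≡⟨ cong (λ x → A ℕ.+ suc n * x) (nCk+nC[k+1]≡[n+1]C[k+1] n k) ⟩
  suc (suc n) * (suc n C suc k) ∎
  where
  open ≡.≡-Reasoning
  A = suc n C suc k
  B = suc n C suc (suc k)

[1+n]Cn≡1+n : ∀ n → suc n C n ≡ suc n
[1+n]Cn≡1+n n = begin
  suc n C n             ≡⟨ nCk≡nC[n∸k] (ℕP.n≤1+n n) ⟩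
  suc n C (suc n ∸ n)   ≡⟨ cong (suc n C_) (ℕP.m+n∸n≡m 1 n) ⟩
  suc n C 1             ≡⟨ nC1≡n (suc n) ⟩
  suc n                 ∎
  where open ≡.≡-Reasoning

p∣pCk : ∀ {p k} → Prime p → 0 < k → k < p → p ∣ p C k
p∣pCk {suc n} {suc k} p-prime _ k<p
  with euclidsLemma (suc k) (suc n C suc k) p-prime
         (divides (n C k) (≡.trans ([1+k]*[1+n]C[1+k]≡[1+n]*nCk n k) (ℕP.*-comm (suc n) (n C k))))
... | inj₁ p∣k   = contradiction (∣⇒≤ p∣k) (ℕP.<⇒≱ k<p)
... | inj₂ p∣pCk = p∣pCk

p∣[p+m]Ck : ∀ {p m k} → Prime p → m < k → k < p → p ∣ (p ℕ.+ m) C k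
p∣[p+m]Ck {p} {zero}  {k}     p-prime m<k k<p =
  subst (λ n → p ∣ n C k) (≡.sym (ℕP.+-identityʳ p)) (p∣pCk p-prime m<k k<p)
p∣[p+m]Ck {p} {suc m} {suc k} p-prime (s≤s m<k) k<p =
  subst (λ n → p ∣ n C suc k) (≡.sym (ℕP.+-suc p m))
    (subst (p ∣_) (nCk+nC[k+1]≡[n+1]C[k+1] (p ℕ.+ m) k)
      (∣m∣n⇒∣m+n (p∣[p+m]Ck p-prime m<k (ℕP.<-trans (ℕP.n<1+n k) k<p))
                 (p∣[p+m]Ck p-prime (ℕP.m<n⇒m<1+n m<k) k<p)))

prime≥2 : ∀ {p} → Prime p → 2 ≤ p
prime≥2 {p} p-prime = nonTrivial⇒n>1 p {{prime⇒nonTrivial p-prime}}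

suc[p∸1]≡p : ∀ {p} → Prime p → suc (p ∸ 1) ≡ p
suc[p∸1]≡p p-prime = ℕP.m+[n∸m]≡n (ℕP.<⇒≤ (prime≥2 p-prime))

p∣mC[p∸1] : ∀ {p m} → Prime p → p ≤ m → suc m < 2 * p → p ∣ m C (p ∸ 1)
p∣mC[p∸1] {p} {m} p-prime p≤m 1+m<2p =
  subst (λ n → p ∣ n C (p ∸ 1)) (ℕP.m+[n∸m]≡n p≤m) (p∣[p+m]Ck p-prime j<p∸1 p∸1<p)
  where
  j = m ∸ p
  p∸1<p : p ∸ 1 < p
  p∸1<p = subst (p ∸ 1 <_) (suc[p∸1]≡p p-prime) (ℕP.n<1+n (p ∸ 1))
  2+j≤p : suc (suc j) ≤ p
  2+j≤p = begin
    suc (suc j)             ≡⟨ ℕP.+-∸-assoc 2 p≤m ⟨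
    suc (suc m) ∸ p         ≤⟨ ℕP.∸-monoˡ-≤ p 1+m<2p ⟩
    p ℕ.+ (p ℕ.+ 0) ∸ p     ≡⟨ ≡.trans (ℕP.m+n∸m≡n p (p ℕ.+ 0)) (ℕP.+-identityʳ p) ⟩
    p                       ∎
    where open ℕP.≤-Reasoning
  j<p∸1 : j < p ∸ 1
  j<p∸1 = ℕP.∸-monoˡ-≤ 1 2+j≤p

∤⇒≢0 : ∀ {d n} → ¬ d ∣ n → n ≢ 0
∤⇒≢0 {d} d∤0 refl = d∤0 (d ∣0)

∤⇒≢ : ∀ {d n} → ¬ d ∣ n → n ≢ d
∤⇒≢ d∤d refl = d∤d ∣-refl

¬p∣⇒coprime : ∀ {p n} → Prime p → ¬ p ∣ n → Coprime n p
¬p∣⇒coprime p-prime p∤n (d∣n , d∣p) with prime⇒irreducible p-prime d∣p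
... | inj₁ d≡1  = d≡1
... | inj₂ refl = contradiction d∣n p∤n

0<m<2p∧m≢p⇒p∤m : ∀ {p m} → 0 < m → m < 2 * p → m ≢ p → ¬ p ∣ m
0<m<2p∧m≢p⇒p∤m     0<m m<2p m≢p (divides zero refl)          = contradiction 0<m (λ ())
0<m<2p∧m≢p⇒p∤m {p} 0<m m<2p m≢p (divides 1 refl)             = m≢p (ℕP.+-identityʳ p)
0<m<2p∧m≢p⇒p∤m {p} 0<m m<2p m≢p (divides (suc (suc q)) refl) =
  contradiction m<2p (ℕP.≤⇒≯ (ℕP.+-monoʳ-≤ p (ℕP.+-monoʳ-≤ p (z≤n {q * p}))))

even<2p⇒suc<2p : ∀ {r p} → 2 ∣ r → r < 2 * p → suc r < 2 * p
even<2p⇒suc<2p {r} {p} (divides q refl) r<2p with ℕP.m≤n⇒m<n∨m≡n r<2p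
... | inj₁ 1+r<2p = 1+r<2p
... | inj₂ 1+r≡2p =
  contradiction (≡.trans (≡.sym 1+r≡2p) (cong suc (ℕP.*-comm q 2))) (ℕP.even≢odd p q)

v≡1+u⇒v-u≡1 : ∀ {u v} → v ≡ 1 ℕ.+ u → + v ℤ.- + u ≡ + 1
v≡1+u⇒v-u≡1 {u} refl = ≡.trans (cong (ℤ._- + u) (ℤP.pos-+ 1 u)) (cancel (+ u))
  where
  cancel : ∀ a → (+ 1 ℤ.+ a) ℤ.- a ≡ + 1
  cancel = solve-∀

sl2-completion : ∀ {k p} → Coprime k p → ∃₂ λ b d → IsSL2 (mat (+ k) b (+ p) d)
sl2-completion {k} {p} k⊥p with coprime-Bézout k⊥p
... | Bézout.+- x y eq = + y , + x , (begin
  + k ℤ.* + x ℤ.- + y ℤ.* + p    ≡⟨ cong (ℤ._- + y ℤ.* + p) (ℤP.*-comm (+ k) (+ x)) ⟩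
  + x ℤ.* + k ℤ.- + y ℤ.* + p    ≡⟨ cong₂ ℤ._-_ (ℤP.pos-* x k) (ℤP.pos-* y p) ⟨
  + (x * k) ℤ.- + (y * p)        ≡⟨ v≡1+u⇒v-u≡1 (≡.sym eq) ⟩
  + 1                            ∎)
  where open ≡.≡-Reasoning
... | Bézout.-+ x y eq = ℤ.- + y , ℤ.- + x , (begin
  + k ℤ.* ℤ.- + x ℤ.- ℤ.- + y ℤ.* + p  ≡⟨ swap (+ k) (+ x) (+ y) (+ p) ⟩
  + y ℤ.* + p ℤ.- + x ℤ.* + k          ≡⟨ cong₂ ℤ._-_ (ℤP.pos-* y p) (ℤP.pos-* x k) ⟨
  + (y * p) ℤ.- + (x * k)              ≡⟨ v≡1+u⇒v-u≡1 (≡.sym eq) ⟩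
  + 1                                  ∎)
  where
  open ≡.≡-Reasoning
  swap : ∀ a b c d → a ℤ.* ℤ.- b ℤ.- ℤ.- c ℤ.* d ≡ c ℤ.* d ℤ.- b ℤ.* a
  swap = solve-∀

adj-involutive : ∀ σ → adj (adj σ) ≡ σ
adj-involutive (mat a b c d) =
  cong₂ (λ b′ c′ → mat a b′ c′ d) (ℤP.neg-involutive b) (ℤP.neg-involutive c)

I T S : M2
I = mat (+ 1) 0ℤ 0ℤ (+ 1)
T = mat (+ 1) (+ 1) 0ℤ (+ 1)
S = mat 0ℤ (ℤ.- + 1) (+ 1) 0ℤ

k/p-cusp : ∀ k p b d → act (mat (+ 1) (+ k) 0ℤ (+ p)) (fin 0ℚ) ≡ act (mat (+ k) b (+ p) d) ∞
k/p-cusp k p b d = cong₂ frac (ℚP.+-identityˡ _) (ℚP.+-identityˡ _)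

module _ {c ℓ : Level} (R : CommutativeRing c ℓ) where
  open CommutativeRing R
    renaming (_*_ to _·_; refl to ≈-refl; sym to ≈-sym; trans to ≈-trans)
    hiding (zero)
  open import Algebra.Properties.Ring ring
    using (-0#≈0#; -‿involutive; -‿distribˡ-*; -‿distribʳ-*; +-inverseʳ-unique; -1*x≈-x)
  open import Algebra.Properties.Semiring.Mult semiring
    using (×-homo-+; ×1-homo-*) renaming (_×_ to _×ᴿ_)
  open import Relation.Binary.Reasoning.Setoid setoid

  private
    ι : ℕ → Carrier
    ι = natR R

  natR≈×1# : ∀ n → ι n ≈ n ×ᴿ 1#
  natR≈×1# zero    = ≈-refl
  natR≈×1# (suc n) = +-congˡ (natR≈×1# n)

  natR-+ : ∀ m n → ι (m ℕ.+ n) ≈ ι m + ι n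
  natR-+ m n = ≈-trans (natR≈×1# (m ℕ.+ n))
    (≈-trans (×-homo-+ 1# m n) (≈-sym (+-cong (natR≈×1# m) (natR≈×1# n))))

  natR-* : ∀ m n → ι (m * n) ≈ ι m · ι n
  natR-* m n = ≈-trans (natR≈×1# (m * n))
    (≈-trans (×1-homo-* m n) (≈-sym (*-cong (natR≈×1# m) (natR≈×1# n))))

  intR-neg : ∀ z → intR R (ℤ.- z) ≈ - intR R z
  intR-neg (+ zero)    = ≈-sym -0#≈0#
  intR-neg (+ suc n)   = ≈-refl
  intR-neg ℤ.-[1+ n ]  = ≈-sym (-‿involutive _)

  natR-invertible : ∀ {p n} → HasChar R p → Coprime n p → ∃ λ w → ι n · w ≈ 1#
  natR-invertible {p} {n} char n⊥p with coprime-Bézout n⊥p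
  ... | Bézout.+- x y eq = ι x , (begin
    ι n · ι x            ≈⟨ *-comm (ι n) (ι x) ⟩
    ι x · ι n            ≈⟨ natR-* x n ⟨
    ι (x * n)            ≡⟨ cong ι eq ⟨
    ι (1 ℕ.+ y * p)      ≈⟨ natR-+ 1 (y * p) ⟩
    ι 1 + ι (y * p)      ≈⟨ +-cong (+-identityʳ 1#) (proj₂ (char (y * p)) (divides y refl)) ⟩
    1# + 0#              ≈⟨ +-identityʳ 1# ⟩
    1#                   ∎)
  ... | Bézout.-+ x y eq = - ι x , (begin
    ι n · - ι x          ≈⟨ -‿distribʳ-* (ι n) (ι x) ⟨
    - (ι n · ι x)        ≈⟨ -‿cong (≈-trans (*-comm (ι n) (ι x)) xn≈-1) ⟩
    - - 1#               ≈⟨ -‿involutive 1# ⟩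
    1#                   ∎)
    where
    1+xn≈0 : 1# + ι x · ι n ≈ 0#
    1+xn≈0 = begin
      1# + ι x · ι n     ≈⟨ +-cong (+-identityʳ 1#) (natR-* x n) ⟨
      ι 1 + ι (x * n)    ≈⟨ natR-+ 1 (x * n) ⟨
      ι (1 ℕ.+ x * n)    ≡⟨ cong ι eq ⟩
      ι (y * p)          ≈⟨ proj₂ (char (y * p)) (divides y refl) ⟩
      0#                 ∎
    xn≈-1 : ι x · ι n ≈ - 1#
    xn≈-1 = +-inverseʳ-unique 1# (ι x · ι n) 1+xn≈0

  +≈0 : ∀ {x y} → x ≈ 0# → y ≈ 0# → x + y ≈ 0#
  +≈0 x≈0 y≈0 = ≈-trans (+-cong x≈0 y≈0) (+-identityʳ 0#)

  ·≈0ˡ : ∀ {x} y → x ≈ 0# → x · y ≈ 0#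
  ·≈0ˡ y x≈0 = ≈-trans (*-congʳ x≈0) (zeroˡ y)

  ·≈0ʳ : ∀ x {y} → y ≈ 0# → x · y ≈ 0#
  ·≈0ʳ x y≈0 = ≈-trans (*-congˡ y≈0) (zeroʳ x)

  x-xwu≈0 : ∀ x {u w} → u · w ≈ 1# → x + - (x · w) · u ≈ 0#
  x-xwu≈0 x {u} {w} uw≈1 = begin
    x + - (x · w) · u     ≈⟨ +-congˡ (-‿distribˡ-* (x · w) u) ⟨
    x + - (x · w · u)     ≈⟨ +-congˡ (-‿cong (≈-trans (*-assoc x w u) (*-congˡ (*-comm w u)))) ⟩
    x + - (x · (u · w))   ≈⟨ +-congˡ (-‿cong (≈-trans (*-congˡ uw≈1) (*-identityʳ x))) ⟩
    x - x                 ≈⟨ -‿inverseʳ x ⟩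
    0#                    ∎

  sumFin-zero : ∀ n (f : Fin n → Carrier) → (∀ k → f k ≈ 0#) → sumFin R n f ≈ 0#
  sumFin-zero zero    f f≈0 = ≈-refl
  sumFin-zero (suc n) f f≈0 = +≈0 (f≈0 Fin.zero) (sumFin-zero n (f ∘ Fin.suc) (f≈0 ∘ Fin.suc))

  sumFin-single : ∀ n (f : Fin n → Carrier) k₀ → (∀ k → k ≢ k₀ → f k ≈ 0#) →
                  sumFin R n f ≈ f k₀
  sumFin-single (suc n) f Fin.zero     f≈0 =
    ≈-trans (+-congˡ (sumFin-zero n (f ∘ Fin.suc) (λ k → f≈0 (Fin.suc k) (λ ())))) (+-identityʳ _)
  sumFin-single (suc n) f (Fin.suc k₀) f≈0 =
    ≈-trans (+-cong (f≈0 Fin.zero (λ ())) (sumFin-single n (f ∘ Fin.suc) k₀ f∘suc≈0)) (+-identityˡ _)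
    where
    f∘suc≈0 : ∀ k → k ≢ k₀ → f (Fin.suc k) ≈ 0#
    f∘suc≈0 k k≢k₀ = f≈0 (Fin.suc k) (k≢k₀ ∘ FinP.suc-injective)

  linear : Carrier → Carrier → List Carrier
  linear a b = a ∷ b ∷ []

  IsZeroPoly : List Carrier → Set ℓ
  IsZeroPoly A = ∀ j → coeffAt R A j ≈ 0#

  PureX : List Carrier → Set ℓ
  PureX A = ∀ j → coeffAt R A (suc j) ≈ 0#

  coeffAt-padd : ∀ A B j → coeffAt R (padd R A B) j ≈ coeffAt R A j + coeffAt R B j
  coeffAt-padd []      B       j       = ≈-sym (+-identityˡ _)
  coeffAt-padd (x ∷ A) []      j       = ≈-sym (+-identityʳ _)
  coeffAt-padd (x ∷ A) (y ∷ B) zero    = ≈-refl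
  coeffAt-padd (x ∷ A) (y ∷ B) (suc j) = coeffAt-padd A B j

  coeffAt-pscale : ∀ s A j → coeffAt R (pscale R s A) j ≈ s · coeffAt R A j
  coeffAt-pscale s []      j       = ≈-sym (zeroʳ s)
  coeffAt-pscale s (x ∷ A) zero    = ≈-refl
  coeffAt-pscale s (x ∷ A) (suc j) = coeffAt-pscale s A j

  coeffAt-pmul-∷ : ∀ a A B j →
                   coeffAt R (pmul R (a ∷ A) B) j ≈ a · coeffAt R B j + coeffAt R (0# ∷ pmul R A B) j
  coeffAt-pmul-∷ a A B j = ≈-trans (coeffAt-padd (pscale R a B) _ j) (+-congʳ (coeffAt-pscale a B j))

  pmul-zeroˡ : ∀ A B → IsZeroPoly A → IsZeroPoly (pmul R A B)
  pmul-zeroˡ []      B A≈0 j = ≈-refl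
  pmul-zeroˡ (a ∷ A) B A≈0 j = ≈-trans (coeffAt-pmul-∷ a A B j) (+≈0 (·≈0ˡ _ (A≈0 0)) (tail j))
    where
    tail : ∀ j → coeffAt R (0# ∷ pmul R A B) j ≈ 0#
    tail zero    = ≈-refl
    tail (suc j) = pmul-zeroˡ A B (A≈0 ∘ suc) j

  coeffAt-pmul-pureXˡ : ∀ A B → PureX A → ∀ j → coeffAt R (pmul R A B) j ≈ coeffAt R A 0 · coeffAt R B j
  coeffAt-pmul-pureXˡ []      B _   j = ≈-sym (zeroˡ _)
  coeffAt-pmul-pureXˡ (a ∷ A) B A-X j =
    ≈-trans (coeffAt-pmul-∷ a A B j) (≈-trans (+-congˡ (tail j)) (+-identityʳ _))
    where
    tail : ∀ j → coeffAt R (0# ∷ pmul R A B) j ≈ 0#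
    tail zero    = ≈-refl
    tail (suc j) = pmul-zeroˡ A B A-X j

  coeffAt-pmul-pureXʳ : ∀ A B → PureX B → ∀ j → coeffAt R (pmul R A B) j ≈ coeffAt R A j · coeffAt R B 0
  coeffAt-pmul-pureXʳ []      B _   j       = ≈-sym (zeroˡ _)
  coeffAt-pmul-pureXʳ (a ∷ A) B B-X zero    = ≈-trans (coeffAt-pmul-∷ a A B 0) (+-identityʳ _)
  coeffAt-pmul-pureXʳ (a ∷ A) B B-X (suc j) =
    ≈-trans (coeffAt-pmul-∷ a A B (suc j))
      (≈-trans (+-cong (·≈0ʳ a (B-X j)) (coeffAt-pmul-pureXʳ A B B-X j)) (+-identityˡ _))

  coeffAt-linear-zero : ∀ a b Q → coeffAt R (pmul R (linear a b) Q) 0 ≈ a · coeffAt R Q 0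
  coeffAt-linear-zero a b Q = ≈-trans (coeffAt-pmul-∷ a (b ∷ []) Q 0) (+-identityʳ _)

  coeffAt-linear-suc : ∀ a b Q j →
                       coeffAt R (pmul R (linear a b) Q) (suc j) ≈ a · coeffAt R Q (suc j) + b · coeffAt R Q j
  coeffAt-linear-suc a b Q j =
    ≈-trans (coeffAt-pmul-∷ a (b ∷ []) Q (suc j))
      (+-congˡ (≈-trans (coeffAt-pmul-∷ b [] Q j) (≈-trans (+-congˡ (last j)) (+-identityʳ _))))
    where
    last : ∀ j → coeffAt R (0# ∷ []) j ≈ 0#
    last zero    = ≈-refl
    last (suc j) = ≈-refl

  ppow-pureX : ∀ a {b} → b ≈ 0# → ∀ n → PureX (ppow R (linear a b) n)
  ppow-pureX a     b≈0 zero    j = ≈-refl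
  ppow-pureX a {b} b≈0 (suc n) j =
    ≈-trans (coeffAt-linear-suc a b (ppow R (linear a b) n) j)
            (+≈0 (·≈0ʳ a (ppow-pureX a b≈0 n j)) (·≈0ˡ _ b≈0))

  ppow-pureY : ∀ {a} b → a ≈ 0# → ∀ n j → j ≢ n → coeffAt R (ppow R (linear a b) n) j ≈ 0#
  ppow-pureY     b a≈0 zero    zero    j≢n = contradiction refl j≢n
  ppow-pureY     b a≈0 zero    (suc j) j≢n = ≈-refl
  ppow-pureY {a} b a≈0 (suc n) zero    j≢n =
    ≈-trans (coeffAt-linear-zero a b (ppow R (linear a b) n)) (·≈0ˡ _ a≈0)
  ppow-pureY {a} b a≈0 (suc n) (suc j) j≢n =
    ≈-trans (coeffAt-linear-suc a b (ppow R (linear a b) n) j)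
            (+≈0 (·≈0ˡ _ a≈0) (·≈0ʳ b (ppow-pureY b a≈0 n j (j≢n ∘ cong suc))))

  ppow-zero : ∀ {a b} → a ≈ 0# → b ≈ 0# → ∀ n → IsZeroPoly (ppow R (linear a b) (suc n))
  ppow-zero {a} {b} a≈0 b≈0 n zero    = ppow-pureY b a≈0 (suc n) 0 (λ ())
  ppow-zero {a} {b} a≈0 b≈0 n (suc j) = ppow-pureX a b≈0 (suc n) j

  coeffAt-ppow-unit : ∀ {a} b → a ≈ 1# → ∀ n → coeffAt R (ppow R (linear a b) n) 0 ≈ 1#
  coeffAt-ppow-unit     b a≈1 zero    = ≈-refl
  coeffAt-ppow-unit {a} b a≈1 (suc n) =
    ≈-trans (coeffAt-linear-zero a b (ppow R (linear a b) n))
            (≈-trans (*-cong a≈1 (coeffAt-ppow-unit b a≈1 n)) (*-identityˡ 1#))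

  coeffAt-ppow-binomial : ∀ {a b} → a ≈ 1# → b ≈ 1# →
                          ∀ n j → coeffAt R (ppow R (linear a b) n) j ≈ ι (n C j)
  coeffAt-ppow-binomial         a≈1 b≈1 zero    zero    = ≈-sym (+-identityʳ 1#)
  coeffAt-ppow-binomial         a≈1 b≈1 zero    (suc j) = ≈-refl
  coeffAt-ppow-binomial {a} {b} a≈1 b≈1 (suc n) zero    =
    ≈-trans (coeffAt-linear-zero a b (ppow R (linear a b) n))
            (≈-trans (*-cong a≈1 (coeffAt-ppow-binomial a≈1 b≈1 n 0)) (*-identityˡ _))
  coeffAt-ppow-binomial {a} {b} a≈1 b≈1 (suc n) (suc j) = begin
    coeffAt R (ppow R (linear a b) (suc n)) (suc j)
      ≈⟨ coeffAt-linear-suc a b (ppow R (linear a b) n) j ⟩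
    a · coeffAt R (ppow R (linear a b) n) (suc j) + b · coeffAt R (ppow R (linear a b) n) j
      ≈⟨ +-cong (*-cong a≈1 (coeffAt-ppow-binomial a≈1 b≈1 n (suc j)))
                (*-cong b≈1 (coeffAt-ppow-binomial a≈1 b≈1 n j)) ⟩
    1# · ι (n C suc j) + 1# · ι (n C j)
      ≈⟨ ≈-trans (+-cong (*-identityˡ _) (*-identityˡ _)) (+-comm _ _) ⟩
    ι (n C j) + ι (n C suc j)
      ≈⟨ natR-+ (n C j) (n C suc j) ⟨
    ι (n C j ℕ.+ n C suc j)
      ≡⟨ cong ι (nCk+nC[k+1]≡[n+1]C[k+1] n j) ⟩
    ι (suc n C suc j) ∎

  module _ {r : ℕ} where

    _∣W′_ : W R r → M2 → W R r
    _∣W′_ = _∣W_ R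

    Concentrated : ℕ → W R r → Set ℓ
    Concentrated t F = ∀ k → toℕ k ≢ t → F k ≈ 0#

    X^[r-m] Y^m : M2 → ℕ → List Carrier
    X^[r-m] (mat a b c d) m = ppow R (linear (intR R d) (intR R (ℤ.- c))) (r ∸ m)
    Y^m     (mat a b c d) m = ppow R (linear (intR R (ℤ.- b)) (intR R a)) m

    actionCoeff : M2 → ℕ → ℕ → Carrier
    actionCoeff σ m j = coeffAt R (pmul R (X^[r-m] σ m) (Y^m σ m)) j

    ∣W-concentrated-value : ∀ {F} k₀ σ → Concentrated (toℕ k₀) F →
                            ∀ j → (F ∣W′ σ) j ≈ F k₀ · actionCoeff σ (toℕ k₀) (toℕ j)
    ∣W-concentrated-value {F} k₀ σ F-conc j =
      sumFin-single (suc r) (λ k → F k · actionCoeff σ (toℕ k) (toℕ j)) k₀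
        (λ k k≢k₀ → ·≈0ˡ _ (F-conc k (k≢k₀ ∘ FinP.toℕ-injective)))

    ∣W-concentrated : ∀ {F s} k₀ σ → Concentrated (toℕ k₀) F →
                      (∀ j → j ≢ s → actionCoeff σ (toℕ k₀) j ≈ 0#) → Concentrated s (F ∣W′ σ)
    ∣W-concentrated k₀ σ F-conc row j j≢s =
      ≈-trans (∣W-concentrated-value k₀ σ F-conc j) (·≈0ʳ _ (row (toℕ j) j≢s))

    ∣W-vanishes : ∀ {F} k₀ σ → Concentrated (toℕ k₀) F →
                  (∀ j → actionCoeff σ (toℕ k₀) j ≈ 0#) → ∀ j → (F ∣W′ σ) j ≈ 0#
    ∣W-vanishes k₀ σ F-conc row j =
      ≈-trans (∣W-concentrated-value k₀ σ F-conc j) (·≈0ʳ _ (row (toℕ j)))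

    actionCoeff-diagonal : ∀ a d m j → j ≢ m → actionCoeff (mat a 0ℤ 0ℤ d) m j ≈ 0#
    actionCoeff-diagonal a d m j j≢m =
      ≈-trans (coeffAt-pmul-pureXˡ (X^[r-m] σ m) (Y^m σ m) (ppow-pureX (intR R d) ≈-refl (r ∸ m)) j)
              (·≈0ʳ _ (ppow-pureY (intR R a) ≈-refl m j j≢m))
      where σ = mat a 0ℤ 0ℤ d

    actionCoeff-diagonal-d≈0 : ∀ a d → intR R d ≈ 0# → ∀ m → m < r → ∀ j →
                               actionCoeff (mat a 0ℤ 0ℤ d) m j ≈ 0#
    actionCoeff-diagonal-d≈0 a d d≈0 m m<r j =
      ≈-trans (coeffAt-pmul-pureXˡ (X^[r-m] σ m) (Y^m σ m) (ppow-pureX (intR R d) ≈-refl (r ∸ m)) j)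
              (·≈0ˡ _ (ppow-pureY 0# d≈0 (r ∸ m) 0 (ℕP.<⇒≢ (ℕP.m<n⇒0<n∸m m<r))))
      where σ = mat a 0ℤ 0ℤ d

    actionCoeff-diagonal-a≈0 : ∀ a d → intR R a ≈ 0# → ∀ m → 0 < m → ∀ j →
                               actionCoeff (mat a 0ℤ 0ℤ d) m j ≈ 0#
    actionCoeff-diagonal-a≈0 a d a≈0 (suc m) _ j =
      ≈-trans (coeffAt-pmul-pureXˡ (X^[r-m] σ (suc m)) (Y^m σ (suc m))
                                   (ppow-pureX (intR R d) ≈-refl (r ∸ suc m)) j)
              (·≈0ʳ _ (ppow-zero ≈-refl a≈0 m j))
      where σ = mat a 0ℤ 0ℤ d

    actionCoeff-antidiagonal : ∀ b c m j → j ≢ r ∸ m → actionCoeff (mat 0ℤ b c 0ℤ) m j ≈ 0#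
    actionCoeff-antidiagonal b c m j j≢r-m =
      ≈-trans (coeffAt-pmul-pureXʳ (X^[r-m] σ m) (Y^m σ m) (ppow-pureX (intR R (ℤ.- b)) ≈-refl m) j)
              (·≈0ˡ _ (ppow-pureY (intR R (ℤ.- c)) ≈-refl (r ∸ m) j j≢r-m))
      where σ = mat 0ℤ b c 0ℤ

    actionCoeff-row₀-pureX : ∀ a b c d → intR R (ℤ.- c) ≈ 0# →
                             ∀ j → j ≢ 0 → actionCoeff (mat a b c d) 0 j ≈ 0#
    actionCoeff-row₀-pureX a b c d c≈0 zero    j≢0 = contradiction refl j≢0
    actionCoeff-row₀-pureX a b c d c≈0 (suc j) _   =
      ≈-trans (coeffAt-pmul-pureXʳ (X^[r-m] σ 0) (Y^m σ 0) (λ _ → ≈-refl) (suc j))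
              (·≈0ˡ _ (ppow-pureX (intR R d) c≈0 r j))
      where σ = mat a b c d

    actionCoeff-pureX : ∀ a b c d → intR R (ℤ.- c) ≈ 0# → intR R a ≈ 0# →
                        ∀ m j → j ≢ 0 → actionCoeff (mat a b c d) m j ≈ 0#
    actionCoeff-pureX a b c d c≈0 a≈0 m zero    j≢0 = contradiction refl j≢0
    actionCoeff-pureX a b c d c≈0 a≈0 m (suc j) _   =
      ≈-trans (coeffAt-pmul-pureXˡ (X^[r-m] σ m) (Y^m σ m) (ppow-pureX (intR R d) c≈0 (r ∸ m)) (suc j))
              (·≈0ʳ _ (ppow-pureX (intR R (ℤ.- b)) a≈0 m j))
      where σ = mat a b c d

    actionCoeff-adjT : ∀ m j → actionCoeff (adj T) m j ≈ ι (m C j)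
    actionCoeff-adjT m j = begin
      actionCoeff (adj T) m j
        ≈⟨ coeffAt-pmul-pureXˡ (X^[r-m] (adj T) m) (Y^m (adj T) m) (ppow-pureX (ι 1) ≈-refl (r ∸ m)) j ⟩
      coeffAt R (ppow R (linear (ι 1) 0#) (r ∸ m)) 0 · coeffAt R (ppow R (linear (ι 1) (ι 1)) m) j
        ≈⟨ *-cong (coeffAt-ppow-unit 0# ι1≈1 (r ∸ m)) (coeffAt-ppow-binomial ι1≈1 ι1≈1 m j) ⟩
      1# · ι (m C j)
        ≈⟨ *-identityˡ _ ⟩
      ι (m C j) ∎
      where
      ι1≈1 : ι 1 ≈ 1#
      ι1≈1 = +-identityʳ 1#

    monoW-concentrated : ∀ i → Concentrated (toℕ i) (monoW R i)
    monoW-concentrated i k k≢i with toℕ k ℕ.≟ toℕ i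
    ... | yes k≡i = contradiction k≡i k≢i
    ... | no  _   = ≈-refl

    basis : Fin (suc r) → W R r
    basis t k with k Fin.≟ t
    ... | yes _ = 1#
    ... | no  _ = 0#

    basis-concentrated : ∀ t → Concentrated (toℕ t) (basis t)
    basis-concentrated t k k≢t with k Fin.≟ t
    ... | yes k≡t = contradiction (cong toℕ k≡t) k≢t
    ... | no  _   = ≈-refl

    basis-self : ∀ t → basis t t ≈ 1#
    basis-self t with t Fin.≟ t
    ... | yes _   = ≈-refl
    ... | no  t≢t = contradiction refl t≢t

    -- F(X, X + Y) − F(X, Y)
    translateDiff : W R r → W R r
    translateDiff F k = (F ∣W′ adj T) k - F k

    translate-basis : ∀ t l → (basis t ∣W′ adj T) l ≈ ι (toℕ t C toℕ l)
    translate-basis t l = begin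
      (basis t ∣W′ adj T) l
        ≈⟨ ∣W-concentrated-value t (adj T) (basis-concentrated t) l ⟩
      basis t t · actionCoeff (adj T) (toℕ t) (toℕ l)
        ≈⟨ *-cong (basis-self t) (actionCoeff-adjT (toℕ t) (toℕ l)) ⟩
      1# · ι (toℕ t C toℕ l)
        ≈⟨ *-identityˡ _ ⟩
      ι (toℕ t C toℕ l) ∎

    translateDiff-basis-below : ∀ {m} t → toℕ t ≡ m → ∀ l → toℕ l < m →
                                translateDiff (basis t) l ≈ ι (m C toℕ l)
    translateDiff-basis-below t refl l l<t = begin
      (basis t ∣W′ adj T) l - basis t l
        ≈⟨ +-cong (translate-basis t l) (-‿cong (basis-concentrated t l (ℕP.<⇒≢ l<t))) ⟩
      ι (toℕ t C toℕ l) - 0#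
        ≈⟨ ≈-trans (+-congˡ -0#≈0#) (+-identityʳ _) ⟩
      ι (toℕ t C toℕ l) ∎

    translateDiff-basis-above : ∀ {m} t → toℕ t ≡ m → ∀ l → m ≤ toℕ l →
                                translateDiff (basis t) l ≈ 0#
    translateDiff-basis-above t refl l t≤l with ℕP.m≤n⇒m<n∨m≡n t≤l
    ... | inj₁ t<l = begin
      (basis t ∣W′ adj T) l - basis t l
        ≈⟨ +-cong (translate-basis t l) (-‿cong (basis-concentrated t l (ℕP.>⇒≢ t<l))) ⟩
      ι (toℕ t C toℕ l) - 0#
        ≡⟨ cong (λ n → ι n - 0#) (k>n⇒nCk≡0 t<l) ⟩
      0# - 0#
        ≈⟨ -‿inverseʳ 0# ⟩
      0# ∎
    ... | inj₂ t≡l with FinP.toℕ-injective t≡l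
    ...   | refl = begin
      (basis t ∣W′ adj T) t - basis t t
        ≈⟨ +-cong (translate-basis t t) (-‿cong (basis-self t)) ⟩
      ι (toℕ t C toℕ t) - 1#
        ≡⟨ cong (λ n → ι n - 1#) (nCn≡1 (toℕ t)) ⟩
      ι 1 - 1#
        ≈⟨ ≈-trans (+-congʳ (+-identityʳ 1#)) (-‿inverseʳ 1#) ⟩
      0# ∎

    linear-vanishes : ∀ {μ : V R r} → IsLinear R μ → ∀ G → (∀ k → G k ≈ 0#) → μ G ≈ 0#
    linear-vanishes {μ} (μ-cong , _ , μ-scale) G G≈0 = begin
      μ G                  ≈⟨ μ-cong G (λ k → 0# · G k) (λ k → ≈-trans (G≈0 k) (≈-sym (zeroˡ _))) ⟩
      μ (λ k → 0# · G k)   ≈⟨ μ-scale 0# G ⟩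
      0# · μ G             ≈⟨ zeroˡ (μ G) ⟩
      0#                   ∎

    linear-+-annihilated : ∀ {μ : V R r} → IsLinear R μ → ∀ G U → μ U ≈ 0# →
                           ∀ s → μ (λ k → G k + s · U k) ≈ μ G
    linear-+-annihilated {μ} (_ , μ-+ , μ-scale) G U μU≈0 s = begin
      μ (λ k → G k + s · U k)   ≈⟨ μ-+ G (λ k → s · U k) ⟩
      μ G + μ (λ k → s · U k)   ≈⟨ +-congˡ (≈-trans (μ-scale s U) (·≈0ʳ s μU≈0)) ⟩
      μ G + 0#                  ≈⟨ +-identityʳ (μ G) ⟩
      μ G                       ∎

    invariant-translateDiff : ∀ {μ : V R r} → IsΓ∞Inv R μ → ∀ F → μ (translateDiff F) ≈ 0#
    invariant-translateDiff {μ} ((μ-cong , μ-+ , μ-scale) , μ-inv) F = begin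
      μ (translateDiff F)                      ≈⟨ μ-cong _ _ (λ k → +-congˡ (≈-sym (-1*x≈-x (F k)))) ⟩
      μ (λ k → (F ∣W′ adj T) k + - 1# · F k)   ≈⟨ μ-+ (F ∣W′ adj T) (λ k → - 1# · F k) ⟩
      μ (F ∣W′ adj T) + μ (λ k → - 1# · F k)   ≈⟨ +-cong (μ-inv T refl refl F) (μ-scale (- 1#) F) ⟩
      μ F + - 1# · μ F                         ≈⟨ +-congˡ (-1*x≈-x (μ F)) ⟩
      μ F - μ F                                ≈⟨ -‿inverseʳ (μ F) ⟩
      0#                                       ∎

    Annihilates : V R r → (ℕ → Set) → ℕ → Set (c ⊔ ℓ)
    Annihilates μ E n = ∀ G → (∀ l → n ≤ toℕ l ⊎ E (toℕ l) → G l ≈ 0#) → μ G ≈ 0#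

    module _ {μ : V R r} {E : ℕ → Set} where

      annihilates-zero : IsLinear R μ → Annihilates μ E 0
      annihilates-zero μ-lin G G≈0 = linear-vanishes μ-lin G (λ l → G≈0 l (inj₁ z≤n))

      annihilates-skip : ∀ {n} → E n → Annihilates μ E n → Annihilates μ E (suc n)
      annihilates-skip {n} En ann G G≈0 = ann G (λ l → G≈0 l ∘ widen l)
        where
        widen : ∀ l → n ≤ toℕ l ⊎ E (toℕ l) → suc n ≤ toℕ l ⊎ E (toℕ l)
        widen l (inj₂ El)  = inj₂ El
        widen l (inj₁ n≤l) with ℕP.m≤n⇒m<n∨m≡n n≤l
        ... | inj₁ n<l = inj₁ n<l
        ... | inj₂ n≡l = inj₂ (subst E n≡l En)

      annihilates-concentrated : ∀ {n t} → Annihilates μ E n → t < n → ¬ E t →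
                                 ∀ G → Concentrated t G → μ G ≈ 0#
      annihilates-concentrated {n} {t} ann t<n ¬Et G G-conc = ann G off-support
        where
        off-support : ∀ l → n ≤ toℕ l ⊎ E (toℕ l) → G l ≈ 0#
        off-support l (inj₁ n≤l) = G-conc l (λ l≡t → ℕP.<⇒≱ t<n (subst (n ≤_) l≡t n≤l))
        off-support l (inj₂ El)  = G-conc l (λ l≡t → ¬Et (subst E l≡t El))

      -- Subtract from G the multiple of translateDiff (basis (n + 1)) that cancels its entry at n.
      annihilates-suc : IsΓ∞Inv R μ → ∀ {n w} → suc n ≤ r → ι (suc n) · w ≈ 1# →
                        (∀ l → l < n → E l → ι (suc n C l) ≈ 0#) →
                        Annihilates μ E n → Annihilates μ E (suc n)
      annihilates-suc μ-inv {n} {w} 1+n≤r unit binom ann G G≈0 = begin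
        μ G   ≈⟨ linear-+-annihilated (proj₁ μ-inv) G U (invariant-translateDiff μ-inv (basis t)) s ⟨
        μ H   ≈⟨ ann H H≈0 ⟩
        0#    ∎
        where
        t nᶠ : Fin (suc r)
        t  = Fin.fromℕ< (s≤s 1+n≤r)
        nᶠ = Fin.fromℕ< (s≤s (ℕP.<⇒≤ 1+n≤r))
        t≡1+n : toℕ t ≡ suc n
        t≡1+n = FinP.toℕ-fromℕ< (s≤s 1+n≤r)
        nᶠ≡n : toℕ nᶠ ≡ n
        nᶠ≡n = FinP.toℕ-fromℕ< (s≤s (ℕP.<⇒≤ 1+n≤r))
        U : W R r
        U = translateDiff (basis t)
        s : Carrier
        s = - (G nᶠ · w)
        H : W R r
        H l = G l + s · U l

        H≈0 : ∀ l → n ≤ toℕ l ⊎ E (toℕ l) → H l ≈ 0#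
        H≈0 l l-out with ℕP.<-cmp (toℕ l) n | l-out
        ... | tri< l<n _ _ | inj₁ n≤l = contradiction n≤l (ℕP.<⇒≱ l<n)
        ... | tri< l<n _ _ | inj₂ El  =
          +≈0 (G≈0 l (inj₂ El))
              (·≈0ʳ s (≈-trans (translateDiff-basis-below t t≡1+n l (ℕP.m<n⇒m<1+n l<n))
                               (binom (toℕ l) l<n El)))
        ... | tri> _ _ n<l | _ =
          +≈0 (G≈0 l (inj₁ n<l)) (·≈0ʳ s (translateDiff-basis-above t t≡1+n l n<l))
        ... | tri≈ _ l≡n _ | _ = begin
          G l + s · U l          ≈⟨ +-cong (reflexive (cong G l≡nᶠ)) (*-congˡ U[n]≈1+n) ⟩
          G nᶠ + s · ι (suc n)   ≈⟨ x-xwu≈0 (G nᶠ) unit ⟩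
          0#                     ∎
          where
          l≡nᶠ : l ≡ nᶠ
          l≡nᶠ = FinP.toℕ-injective (≡.trans l≡n (≡.sym nᶠ≡n))
          U[n]≈1+n : U l ≈ ι (suc n)
          U[n]≈1+n = ≈-trans (translateDiff-basis-below t t≡1+n l (ℕP.≤-reflexive (cong suc l≡n)))
                             (reflexive (cong ι (≡.trans (cong (suc n C_) l≡n) ([1+n]Cn≡1+n n))))

    annihilates-Xʳ : ∀ {μ : V R r} → IsΓ∞Inv R μ → 1 ≤ r → ∀ G → Concentrated 0 G → μ G ≈ 0#
    annihilates-Xʳ μ-inv 1≤r =
      annihilates-concentrated {E = λ _ → ⊥}
        (annihilates-suc μ-inv 1≤r (≈-trans (*-identityʳ (ι 1)) (+-identityʳ 1#)) (λ _ ())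
                         (annihilates-zero (proj₁ μ-inv)))
        (s≤s z≤n) (λ ())

    tilde-at-cusp : ∀ (g : BoundGen R r) {γ} → IsSL2 γ → ∀ F →
                    BoundGen.tilde g (act γ ∞) F ≈ BoundGen.lam g (F ∣W′ γ)
    tilde-at-cusp g {γ} γ∈Γ F = ≈-trans (BoundGen.tildeSpec g γ γ∈Γ F)
      (reflexive (cong (λ σ → BoundGen.lam g (F ∣W′ σ)) (adj-involutive γ)))

    tilde-vanishes-Xʳ : ∀ (g : BoundGen R r) → 1 ≤ r → ∀ {a b c d} → IsSL2 (mat a b c d) →
                        intR R (ℤ.- c) ≈ 0# → ∀ G → Concentrated 0 G →
                        BoundGen.tilde g (act (mat a b c d) ∞) G ≈ 0#
    tilde-vanishes-Xʳ g 1≤r {a} {b} {c} {d} γ∈Γ c≈0 G G-conc =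
      ≈-trans (tilde-at-cusp g {mat a b c d} γ∈Γ G)
        (annihilates-Xʳ (BoundGen.lamInv g) 1≤r (G ∣W′ mat a b c d)
          (∣W-concentrated Fin.zero (mat a b c d) G-conc (actionCoeff-row₀-pureX a b c d c≈0)))

    extendDiv-vanishes : ∀ (t : P1 → V R r) D F → All (λ x → t (proj₂ x) F ≈ 0#) D →
                         extendDiv R t D F ≈ 0#
    extendDiv-vanishes t []            F []            = ≈-refl
    extendDiv-vanishes t ((n , x) ∷ D) F (tx≈0 ∷ D≈0) =
      +≈0 (·≈0ʳ (intR R n) tx≈0) (extendDiv-vanishes t D F D≈0)

    boundary-vanishes : ∀ {φ} → IsBoundary R φ → ∀ D F →
                        (∀ g → All (λ x → BoundGen.tilde g (proj₂ x) F ≈ 0#) (proj₁ D)) → φ D F ≈ 0#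
    boundary-vanishes (gs , φ≈Σgs) D F tilde≈0 = ≈-trans (φ≈Σgs D F) (sumGens-vanishes gs)
      where
      sumGens-vanishes : ∀ gs → sumGens R gs (proj₁ D) F ≈ 0#
      sumGens-vanishes []       = ≈-refl
      sumGens-vanishes (g ∷ gs) =
        +≈0 (·≈0ʳ _ (extendDiv-vanishes (BoundGen.tilde g) (proj₁ D) F (tilde≈0 g))) (sumGens-vanishes gs)

    sumSymb-vanishes : ∀ n (f : ℕ → Div0 → V R r) D F → (∀ k → k < n → f k D F ≈ 0#) →
                       sumSymb R n f D F ≈ 0#
    sumSymb-vanishes zero    f D F f≈0 = ≈-refl
    sumSymb-vanishes (suc n) f D F f≈0 =
      +≈0 (f≈0 n (ℕP.n<1+n n)) (sumSymb-vanishes n f D F (λ k k<n → f≈0 k (ℕP.m<n⇒m<1+n k<n)))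

    module _ {p : ℕ} (p-prime : Prime p) (char : HasChar R p) where

      ι-multiple≈0 : ∀ {n} → p ∣ n → ι n ≈ 0#
      ι-multiple≈0 {n} = proj₂ (char n)

      ιp≈0 : ι p ≈ 0#
      ιp≈0 = ι-multiple≈0 ∣-refl

      annihilates-weight<2p : ∀ {μ : V R r} → IsΓ∞Inv R μ → suc r < 2 * p →
                              ∀ n → n ≤ r → Annihilates μ (_≡ p ∸ 1) n
      annihilates-weight<2p μ-inv 1+r<2p zero    _     = annihilates-zero {E = _≡ p ∸ 1} (proj₁ μ-inv)
      annihilates-weight<2p μ-inv 1+r<2p (suc n) 1+n≤r with n ℕ.≟ p ∸ 1
      ... | yes n≡p∸1 = annihilates-skip n≡p∸1 (annihilates-weight<2p μ-inv 1+r<2p n (ℕP.<⇒≤ 1+n≤r))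
      ... | no  n≢p∸1 = annihilates-suc μ-inv 1+n≤r (proj₂ 1+n-invertible) binom
                                        (annihilates-weight<2p μ-inv 1+r<2p n (ℕP.<⇒≤ 1+n≤r))
        where
        1+n≢p : suc n ≢ p
        1+n≢p 1+n≡p = n≢p∸1 (ℕP.suc-injective (≡.trans 1+n≡p (≡.sym (suc[p∸1]≡p p-prime))))
        1+n<2p : suc n < 2 * p
        1+n<2p = ℕP.≤-<-trans (ℕP.m≤n⇒m≤1+n 1+n≤r) 1+r<2p
        1+n-invertible : ∃ λ w → ι (suc n) · w ≈ 1#
        1+n-invertible =
          natR-invertible char (¬p∣⇒coprime p-prime (0<m<2p∧m≢p⇒p∤m (s≤s z≤n) 1+n<2p 1+n≢p))
        binom : ∀ l → l < n → l ≡ p ∸ 1 → ι (suc n C l) ≈ 0#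
        binom l l<n refl = ι-multiple≈0 (p∣mC[p∸1] p-prime p≤1+n (ℕP.≤-<-trans (s≤s 1+n≤r) 1+r<2p))
          where
          p≤1+n : p ≤ suc n
          p≤1+n = subst (_≤ suc n) (suc[p∸1]≡p p-prime) (ℕP.m≤n⇒m≤1+n l<n)

      L-vanishes-weight<2p : ∀ {φ} → 2 ∣ r → IsBoundary R φ → r < 2 * p → (i : Fin (suc r)) →
                             ¬ (p ∸ 1) ∣ toℕ i → ¬ (p ∸ 1) ∣ (r ∸ toℕ i) → Lval R φ i ≈ 0#
      L-vanishes-weight<2p r-even φ-bound r<2p i p∸1∤i p∸1∤r-i =
        boundary-vanishes φ-bound D∞0 F (λ g → at-∞ g ∷ at-0 g ∷ [])
        where
        F = monoW R i
        i<r : toℕ i < r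
        i<r = ℕP.≰⇒> (∤⇒≢0 p∸1∤r-i ∘ ℕP.m≤n⇒m∸n≡0)
        r-i<r : r ∸ toℕ i < r
        r-i<r = ℕP.∸-monoʳ-< (ℕP.n≢0⇒n>0 (∤⇒≢0 p∸1∤i)) (ℕP.<⇒≤ i<r)
        killed : (g : BoundGen R r) → ∀ {t} → t < r → ¬ (p ∸ 1) ∣ t →
                 ∀ G → Concentrated t G → BoundGen.lam g G ≈ 0#
        killed g t<r p∸1∤t = annihilates-concentrated
          (annihilates-weight<2p (BoundGen.lamInv g) (even<2p⇒suc<2p {p = p} r-even r<2p) r ℕP.≤-refl)
          t<r (∤⇒≢ p∸1∤t)
        at-∞ : (g : BoundGen R r) → BoundGen.tilde g ∞ F ≈ 0#
        at-∞ g = ≈-trans (tilde-at-cusp g {I} refl F)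
          (killed g i<r p∸1∤i (F ∣W′ I)
            (∣W-concentrated i I (monoW-concentrated i) (actionCoeff-diagonal (+ 1) (+ 1) (toℕ i))))
        at-0 : (g : BoundGen R r) → BoundGen.tilde g (fin 0ℚ) F ≈ 0#
        at-0 g = ≈-trans (tilde-at-cusp g {S} refl F)
          (killed g r-i<r p∸1∤r-i (F ∣W′ S)
            (∣W-concentrated i S (monoW-concentrated i) (actionCoeff-antidiagonal (ℤ.- + 1) (+ 1) (toℕ i))))

      hecke-upper-term-vanishes : ∀ {φ} → IsBoundary R φ → 1 ≤ r → ∀ k → suc k < p → ∀ i →
                                  (_∣S_ R φ (mat (+ 1) (+ suc k) 0ℤ (+ p))) D∞0 (monoW R i) ≈ 0#
      hecke-upper-term-vanishes φ-bound 1≤r k 1+k<p i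
        with sl2-completion (Coprimality.sym (Coprimality.prime⇒coprime p-prime 1+k<p))
      ... | b , d , γ∈Γ = boundary-vanishes φ-bound (actDiv0 σ D∞0) G (λ g → at-∞ g ∷ at-k/p g ∷ [])
        where
        σ = mat (+ 1) (+ suc k) 0ℤ (+ p)
        G = monoW R i ∣W′ adj σ
        G-conc : Concentrated 0 G
        G-conc = ∣W-concentrated i (adj σ) (monoW-concentrated i)
                   (actionCoeff-pureX (+ p) (ℤ.- + suc k) 0ℤ (+ 1) ≈-refl ιp≈0 (toℕ i))
        -p≈0 : intR R (ℤ.- + p) ≈ 0#
        -p≈0 = ≈-trans (intR-neg (+ p)) (≈-trans (-‿cong ιp≈0) -0#≈0#)
        at-∞ : (g : BoundGen R r) → BoundGen.tilde g ∞ G ≈ 0#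
        at-∞ g = tilde-vanishes-Xʳ g 1≤r {+ 1} {0ℤ} {0ℤ} {+ 1} refl ≈-refl G G-conc
        at-k/p : (g : BoundGen R r) → BoundGen.tilde g (act σ (fin 0ℚ)) G ≈ 0#
        at-k/p g = ≈-trans (reflexive (cong (λ x → BoundGen.tilde g x G) (k/p-cusp (suc k) p b d)))
                           (tilde-vanishes-Xʳ g 1≤r {+ suc k} {b} {+ p} {d} γ∈Γ -p≈0 G G-conc)

      L-vanishes-Tp-fixed : ∀ {φ} → IsSymbol R φ → IsBoundary R φ →
                            ((D : Div0) → _≈V_ R (Tp R p φ D) (φ D)) →
                            (i : Fin (suc r)) → toℕ i ≢ 0 → toℕ i ≢ r → Lval R φ i ≈ 0#
      L-vanishes-Tp-fixed {φ} ((φ-linear , _) , _) φ-bound Tpφ≈φ i i≢0 i≢r =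
        ≈-trans (≈-sym (Tpφ≈φ D∞0 F)) (+≈0 diagonal-term (sumSymb-vanishes p _ D∞0 F upper-term))
        where
        F = monoW R i
        i<r : toℕ i < r
        i<r = ℕP.≤∧≢⇒< (ℕP.≤-pred (FinP.toℕ<n i)) i≢r
        1≤r : 1 ≤ r
        1≤r = ℕP.≤-trans (ℕP.n≢0⇒n>0 i≢0) (ℕP.<⇒≤ i<r)
        diagonal-term : (_∣S_ R φ (mat (+ p) 0ℤ 0ℤ (+ 1))) D∞0 F ≈ 0#
        diagonal-term = linear-vanishes (φ-linear _) _
          (∣W-vanishes i (mat (+ 1) 0ℤ 0ℤ (+ p)) (monoW-concentrated i)
            (actionCoeff-diagonal-d≈0 (+ 1) (+ p) ιp≈0 (toℕ i) i<r))
        upper-term : ∀ k → k < p → (_∣S_ R φ (mat (+ 1) (+ k) 0ℤ (+ p))) D∞0 F ≈ 0#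
        upper-term zero    _     = linear-vanishes (φ-linear _) _
          (∣W-vanishes i (mat (+ p) 0ℤ 0ℤ (+ 1)) (monoW-concentrated i)
            (actionCoeff-diagonal-a≈0 (+ p) (+ 1) ιp≈0 (toℕ i) (ℕP.n≢0⇒n>0 i≢0)))
        upper-term (suc k) 1+k<p = hecke-upper-term-vanishes φ-bound 1≤r k 1+k<p i

proposition7p6 : ∀ {c ℓ : Level} (R : CommutativeRing c ℓ) (p : ℕ) → Prime p → HasChar R p →
    (r : ℕ) → 2 ∣ r → (φ : Div0 → V R r) → IsSymbol R φ → IsBoundary R φ →
    ((r < 2 * p → (i : Fin (suc r)) →
        ¬ ((p ∸ 1) ∣ toℕ i) → ¬ ((p ∸ 1) ∣ (r ∸ toℕ i)) →
        CommutativeRing._≈_ R (Lval R φ i) (CommutativeRing.0# R))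
    ×
     (((D : Div0) → _≈V_ R (Tp R p φ D) (φ D)) → (i : Fin (suc r)) → toℕ i ≢ 0 → toℕ i ≢ r →
        CommutativeRing._≈_ R (Lval R φ i) (CommutativeRing.0# R)))
proposition7p6 R p p-prime char r r-even φ φ-symbol φ-boundary =
  L-vanishes-weight<2p R p-prime char r-even φ-boundary ,
  L-vanishes-Tp-fixed R p-prime char φ-symbol φ-boundary
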